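{- Let $X$ be a finite non-empty set and $R$ a transit function on $X$ satisfying (mm): for all $x,y,u,v\in X$, if $R(x,y)\cap R(u,v)\neq\emptyset$ then there are $p,q\in R(x,y)\cup R(u,v)$ such that $R(x,y)\cup R(u,v)\subseteq R(p,q)$. Then $R$ satisfies (a'): there exist $u,v\in X$ with $R(u,v)=X$.
   Context: A transit function on a finite non-empty set $X$ is a map $R:X\times X\to 2^X$ such that for all $u,v\in X$: $u\in R(u,v)$, $R(u,v)=R(v,u)$, and $R(u,u)=\{u\}$. -}

module Defs where

open import Data.Nat using (ℕ; suc)
open import Data.Fin using (Fin)
open import Data.Fin.Subset using (Subset; _∈_; _⊆_; _∪_; _∩_; Nonempty; ⁅_⁆)
open import Data.Product using (_×_; ∃₂)
open import Relation.Binary.PropositionalEquality using (_≡_)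

record IsTransit {n : ℕ} (R : Fin n → Fin n → Subset n) : Set where
  field
    extensive : ∀ u v → u ∈ R u v
    symmetric : ∀ u v → R u v ≡ R v u
    idempotent : ∀ u → R u u ≡ ⁅ u ⁆

MM : {n : ℕ} → (Fin n → Fin n → Subset n) → Set
MM {n} R = ∀ (x y u v : Fin n) → Nonempty (R x y ∩ R u v) →
  ∃₂ λ (p q : Fin n) → p ∈ (R x y ∪ R u v) × q ∈ (R x y ∪ R u v)
                       × (R x y ∪ R u v) ⊆ R p q

{-# OPTIONS --safe #-}
module Submission where

-- Any interval R u v can be enlarged to one also containing a given point w: the intervals
-- R u v and R u w meet in u, so (mm) provides an interval R p q containing both. Starting from
-- a degenerate interval and absorbing the points of X one at a time ends with an interval
-- equal to X.

open import Defs
open import Data.Nat using (ℕ; suc)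
open import Data.Fin using (Fin; zero)
open import Data.Fin.Subset using (Subset; ⊤; _∈_; _⊆_)
open import Data.Fin.Subset.Properties using (⊆-antisym; ⊆⊤; p⊆p∪q; q⊆p∪q; x∈p∩q⁺)
open import Data.Product using (∃₂; _×_; _,_)
open import Data.List using (List; []; _∷_; allFin)
open import Data.List.Relation.Unary.All using (All; []; _∷_; lookup)
import Data.List.Relation.Unary.All as All
open import Data.List.Membership.Propositional.Properties using (∈-allFin)
open import Relation.Binary.PropositionalEquality using (_≡_; subst)

module _ {n : ℕ} {R : Fin n → Fin n → Subset n} (transit : IsTransit R) (mm : MM R) where
  open IsTransit transit

  extensiveʳ : ∀ u v → v ∈ R u v
  extensiveʳ u v = subst (v ∈_) (symmetric v u) (extensive v u)

  enlarge : ∀ u v w → ∃₂ λ p q → R u v ⊆ R p q × w ∈ R p q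
  enlarge u v w with mm u v u w (u , x∈p∩q⁺ (extensive u v , extensive u w))
  ... | p , q , _ , _ , R∪R⊆Rpq =
    p , q , (λ x∈Ruv → R∪R⊆Rpq (p⊆p∪q (R u w) x∈Ruv))
          , R∪R⊆Rpq (q⊆p∪q (R u v) (R u w) (extensiveʳ u w))

  interval-covering : Fin n → (xs : List (Fin n)) → ∃₂ λ u v → All (_∈ R u v) xs
  interval-covering z []       = z , z , []
  interval-covering z (w ∷ xs) with interval-covering z xs
  ... | u , v , xs⊆Ruv with enlarge u v w
  ...   | p , q , Ruv⊆Rpq , w∈Rpq = p , q , w∈Rpq ∷ All.map Ruv⊆Rpq xs⊆Ruv

lemma2 : (n : ℕ) (R : Fin (suc n) → Fin (suc n) → Subset (suc n)) → IsTransit R → MM R → ∃₂ λ (u v : Fin (suc n)) → R u v ≡ ⊤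
lemma2 n R transit mm with interval-covering transit mm zero (allFin (suc n))
... | u , v , X⊆Ruv = u , v , ⊆-antisym ⊆⊤ (λ {x} _ → lookup X⊆Ruv (∈-allFin x))
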